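{- Let $G$ be a finite graph with at least two vertices such that, when Tron is played rationally on $G$, $\left(\mathcal{B}/\mathcal{A}\right)_G > 1$. Let $F$ be the graph obtained from $G$ by adding one new vertex $v$ adjacent to every vertex of $G$. Then, with Tron played rationally on $F$, $$\left(\frac{\mathcal{A}}{\mathcal{B}}\right)_{F} \geq \left(\frac{\mathcal{B}}{\mathcal{A}}\right)_{G}.$$
   Context: Tron on an undirected graph $G$ is a two-player game with complete information. The first player (Alice) picks a start vertex; then the second player (Bob) picks a different start vertex. The players then alternate turns, Alice first; in a turn a player moves from his or her current vertex to an adjacent vertex that has not yet been visited by either player (start vertices count as visited). A player with no legal move is skipped, and the game ends when neither player can move. $\mathcal{A}$ and $\mathcal{B}$ denote the numbers of vertices traversed (including the start vertex) by Alice and Bob respectively, and the outcome of the game is $\mathcal{B}/\mathcal{A}$. Rational play means Bob plays to maximize the outcome and Alice plays to minimize it; $(\cdot)_G$ denotes the value of the quantity when both play rationally on $G$. -}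

module Defs where

open import Data.Nat using (ℕ; zero; suc)
open import Data.Fin using (Fin; zero; suc; _≟_)
open import Data.Bool using (Bool; true; false; if_then_else_; not; _∧_)
open import Data.List.Base using (List; []; _∷_; map; foldr; filterᵇ; allFin)
open import Data.Integer using (+_)
open import Data.Rational using (ℚ; _/_; _⊔_; _⊓_; 0ℚ)
open import Relation.Nullary.Decidable using (does)
open import Relation.Binary.PropositionalEquality using (_≡_; refl)

record Graph (n : ℕ) : Set where
  field
    adj        : Fin n → Fin n → Bool
    adj-sym    : ∀ u v → adj u v ≡ adj v u
    adj-irrefl : ∀ v → adj v v ≡ false

data Player : Set where
  alice bob : Player

same : Player → Player → Bool
same alice alice = true
same bob   bob   = true
same _     _     = false

optimum : Bool → ℚ → List ℚ → ℚ
optimum true  x xs = foldr _⊔_ x xs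
optimum false x xs = foldr _⊓_ x xs

-- Tron on G, where `maximizer` maximizes and the other player minimizes
-- the terminal payoff `payoff A B` (A, B = numbers of vertices traversed).
module Tron {n : ℕ} (G : Graph n) (maximizer : Player) (payoff : ℕ → ℕ → ℚ) where
  open Graph G

  Visited : Set
  Visited = Fin n → Bool

  visit : Fin n → Visited → Visited
  visit v vis u = if does (u ≟ v) then true else vis u

  moves : Visited → Fin n → List (Fin n)
  moves vis p = filterᵇ (λ w → adj p w ∧ not (vis w)) (allFin n)

  isMax : Player → Bool
  isMax p = same p maximizer

  -- player p chooses among the options (default 0ℚ on an empty list, never
  -- used in the game below since choices are only offered when non-empty)
  choose : Player → (Fin n → ℚ) → List (Fin n) → ℚ
  choose p f []       = 0ℚ
  choose p f (w ∷ ws) = optimum (isMax p) (f w) (map f ws)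

  -- A player with no legal move is skipped; the game ends
  -- when neither can move. Every step visits a new vertex, so fuel n suffices.
  play : ℕ → Player → Visited → Fin n → Fin n → ℕ → ℕ → ℚ
  play zero    _     vis pa pb a b = payoff a b
  play (suc k) alice vis pa pb a b with moves vis pa | moves vis pb
  ... | w ∷ ws | _      = choose alice (λ x → play k bob   (visit x vis) x pb (suc a) b) (w ∷ ws)
  ... | []     | w ∷ ws = choose bob   (λ x → play k alice (visit x vis) pa x a (suc b)) (w ∷ ws)
  ... | []     | []     = payoff a b
  play (suc k) bob   vis pa pb a b with moves vis pb | moves vis pa
  ... | w ∷ ws | _      = choose bob   (λ x → play k alice (visit x vis) pa x a (suc b)) (w ∷ ws)
  ... | []     | w ∷ ws = choose alice (λ x → play k bob   (visit x vis) x pb (suc a) b) (w ∷ ws)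
  ... | []     | []     = payoff a b

  -- Alice picks a start vertex s, Bob picks t ≠ s, then Alice moves first.
  value : ℚ
  value = choose alice
    (λ s → choose bob
      (λ t → play n alice (visit t (visit s (λ _ → false))) s t 1 1)
      (filterᵇ (λ t → not (does (t ≟ s))) (allFin n)))
    (allFin n)

-- payoffs B/A and A/B (A, B ≥ 1 in every reachable terminal position)
ratioBA : ℕ → ℕ → ℚ
ratioBA zero    b = 0ℚ
ratioBA (suc a) b = (+ b) / suc a

ratioAB : ℕ → ℕ → ℚ
ratioAB a zero    = 0ℚ
ratioAB a (suc b) = (+ a) / suc b

valueBA : ∀ {n} → Graph n → ℚ
valueBA G = Tron.value G bob ratioBA

-- (A/B)_G : the value of A/B under the same rational play; since A/B is a
-- strictly decreasing function of B/A, this is the game where Bob minimizes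
-- A/B and Alice maximizes it (= 1 / (B/A)_G).
valueAB : ∀ {n} → Graph n → ℚ
valueAB G = Tron.value G alice ratioAB

addApex : ∀ {n} → Graph n → Graph (suc n)
addApex {n} G = record { adj = a ; adj-sym = s ; adj-irrefl = i }
  where
  open Graph G
  a : Fin (suc n) → Fin (suc n) → Bool
  a zero    zero    = false
  a zero    (suc _) = true
  a (suc _) zero    = true
  a (suc u) (suc v) = adj u v
  s : ∀ u v → a u v ≡ a v u
  s zero    zero    = refl
  s zero    (suc _) = refl
  s (suc _) zero    = refl
  s (suc u) (suc v) = adj-sym u v
  i : ∀ v → a v v ≡ false
  i zero    = refl
  i (suc v) = adj-irrefl v

module Submission where

-- On F = G + apex, Alice (who in F maximizes A/B) starts on the
-- apex.  Whatever vertex Bob then picks, Alice's first move enters G, and from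
-- that point the game on F is a game on G with the roles exchanged: F-Alice
-- plays the part of G-Bob (both maximize), F-Bob the part of G-Alice (both
-- minimize), and the apex remains visited for ever, so it is never reachable.
-- A terminal position with counts (A , B) in G thus corresponds to the terminal
-- position (B + 1 , A) in F, whose payoff (B + 1)/A dominates B/A.

open import Defs
open import Data.Nat using (ℕ; _≤_; zero; suc; s≤s; z≤n)
open import Data.Nat.Properties using (n≤1+n)
open import Data.Fin using (Fin; zero; suc; _≟_)
open import Data.Bool using (Bool; true; false; if_then_else_; not; _∧_)
open import Data.List.Base using (List; []; _∷_; map; foldr; filterᵇ; allFin; tabulate)
open import Data.List.Properties using (map-∘; map-tabulate)
open import Data.Integer using (+_; +≤+)
open import Data.Integer.Properties using (*-monoʳ-≤-nonNeg)
open import Data.Rational using (ℚ; _/_; _⊔_; 1ℚ) renaming (_<_ to _<ℚ_; _≤_ to _≤ℚ_)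
open import Data.Rational.Properties
  using (toℚᵘ-cancel-≤; toℚᵘ-fromℚᵘ; ⊔-mono-≤; ⊓-mono-≤; ≤-refl; ≤-trans; p≤q⇒p≤r⊔q)
open import Data.Rational.Unnormalised using (mkℚᵘ; *≤*)
open import Data.Rational.Unnormalised.Properties using (≤-respˡ-≃; ≤-respʳ-≃; ≃-sym)
open import Data.Empty using (⊥-elim)
open import Function using (id; _∘_)
open import Relation.Nullary.Decidable using (does)
open import Relation.Binary.PropositionalEquality using (_≡_; refl; sym; trans; cong; _≢_; module ≡-Reasoning)

numerator-mono : ∀ a b → (+ b) / suc a ≤ℚ (+ suc b) / suc a
numerator-mono a b = toℚᵘ-cancel-≤
  (≤-respˡ-≃ (≃-sym (toℚᵘ-fromℚᵘ (mkℚᵘ (+ b) a)))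
    (≤-respʳ-≃ (≃-sym (toℚᵘ-fromℚᵘ (mkℚᵘ (+ suc b) a)))
      (*≤* (*-monoʳ-≤-nonNeg (+ suc a) (+≤+ (n≤1+n b))))))

-- A terminal position (A , B) of G, scored B/A, is dominated by the
-- corresponding terminal position (B + 1 , A) of F, scored A/B.
ratioBA≤ratioAB : ∀ a b → ratioBA a b ≤ℚ ratioAB (suc b) a
ratioBA≤ratioAB zero    b = ≤-refl
ratioBA≤ratioAB (suc a) b = numerator-mono a b

optimum-mono : ∀ opt {A : Set} (f g : A → ℚ) → (∀ x → f x ≤ℚ g x) → ∀ w ws →
               optimum opt (f w) (map f ws) ≤ℚ optimum opt (g w) (map g ws)
optimum-mono true  f g f≤g w []       = f≤g w
optimum-mono true  f g f≤g w (y ∷ ys) = ⊔-mono-≤ (f≤g y) (optimum-mono true f g f≤g w ys)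
optimum-mono false f g f≤g w []       = f≤g w
optimum-mono false f g f≤g w (y ∷ ys) = ⊓-mono-≤ (f≤g y) (optimum-mono false f g f≤g w ys)

optimum-mono-suc : ∀ {n} opt (f : Fin n → ℚ) (g : Fin (suc n) → ℚ) →
                   (∀ x → f x ≤ℚ g (suc x)) → ∀ w ws →
                   optimum opt (f w) (map f ws) ≤ℚ optimum opt (g (suc w)) (map g (map suc ws))
optimum-mono-suc opt f g f≤g w ws rewrite sym (map-∘ {g = g} {f = suc} ws) =
  optimum-mono opt f (g ∘ suc) f≤g w ws

seed≤max : ∀ x xs → x ≤ℚ foldr _⊔_ x xs
seed≤max x []       = ≤-refl
seed≤max x (y ∷ ys) = p≤q⇒p≤r⊔q y (seed≤max x ys)

filter-map-suc : ∀ {m} (P : Fin (suc m) → Bool) (Q : Fin m → Bool) → (∀ x → P (suc x) ≡ Q x) →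
                 ∀ xs → filterᵇ P (map suc xs) ≡ map suc (filterᵇ Q xs)
filter-map-suc P Q P∘suc≡Q []       = refl
filter-map-suc P Q P∘suc≡Q (x ∷ xs) rewrite P∘suc≡Q x with Q x
... | true  = cong (suc x ∷_) (filter-map-suc P Q P∘suc≡Q xs)
... | false = filter-map-suc P Q P∘suc≡Q xs

allFin-suc : ∀ m → allFin (suc m) ≡ zero ∷ map suc (allFin m)
allFin-suc m = cong (zero ∷_) (sym (map-tabulate id suc))

filter-reject : ∀ {A : Set} (P : A → Bool) {x} → P x ≡ false → ∀ xs → filterᵇ P (x ∷ xs) ≡ filterᵇ P xs
filter-reject P Px≡false xs rewrite Px≡false = refl

filter-shift : ∀ {m} (P : Fin (suc m) → Bool) (Q : Fin m → Bool) → P zero ≡ false →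
               (∀ x → P (suc x) ≡ Q x) → filterᵇ P (allFin (suc m)) ≡ map suc (filterᵇ Q (allFin m))
filter-shift {m} P Q P0≡false P∘suc≡Q = begin
  filterᵇ P (allFin (suc m))            ≡⟨ cong (filterᵇ P) (allFin-suc m) ⟩
  filterᵇ P (zero ∷ map suc (allFin m)) ≡⟨ filter-reject P P0≡false (map suc (allFin m)) ⟩
  filterᵇ P (map suc (allFin m))        ≡⟨ filter-map-suc P Q P∘suc≡Q (allFin m) ⟩
  map suc (filterᵇ Q (allFin m))        ∎
  where open ≡-Reasoning

filter-all : ∀ {A : Set} (xs : List A) → filterᵇ (λ _ → true) xs ≡ xs
filter-all []       = refl
filter-all (x ∷ xs) = cong (x ∷_) (filter-all xs)

-- One round of `play`, with the two move lists passed explicitly so that they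
-- can be rewritten before the case split on them.
module Unfolding {n : ℕ} (G : Graph n) (maximizer : Player) (payoff : ℕ → ℕ → ℚ) where
  open Tron G maximizer payoff

  afterAlice afterBob : ℕ → Visited → Fin n → Fin n → ℕ → ℕ → Fin n → ℚ
  afterAlice k vis pa pb a b x = play k bob   (visit x vis) x pb (suc a) b
  afterBob   k vis pa pb a b x = play k alice (visit x vis) pa x a (suc b)

  aliceTurn bobTurn : ℕ → Visited → Fin n → Fin n → ℕ → ℕ → List (Fin n) → List (Fin n) → ℚ
  aliceTurn k vis pa pb a b (w ∷ ws) _        = choose alice (afterAlice k vis pa pb a b) (w ∷ ws)
  aliceTurn k vis pa pb a b []       (w ∷ ws) = choose bob   (afterBob   k vis pa pb a b) (w ∷ ws)
  aliceTurn k vis pa pb a b []       []       = payoff a b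
  bobTurn   k vis pa pb a b (w ∷ ws) _        = choose bob   (afterBob   k vis pa pb a b) (w ∷ ws)
  bobTurn   k vis pa pb a b []       (w ∷ ws) = choose alice (afterAlice k vis pa pb a b) (w ∷ ws)
  bobTurn   k vis pa pb a b []       []       = payoff a b

  play-alice : ∀ k vis pa pb a b →
               play (suc k) alice vis pa pb a b ≡ aliceTurn k vis pa pb a b (moves vis pa) (moves vis pb)
  play-alice k vis pa pb a b with moves vis pa | moves vis pb
  ... | w ∷ ws | _      = refl
  ... | []     | w ∷ ws = refl
  ... | []     | []     = refl

  play-bob : ∀ k vis pa pb a b →
             play (suc k) bob vis pa pb a b ≡ bobTurn k vis pa pb a b (moves vis pb) (moves vis pa)
  play-bob k vis pa pb a b with moves vis pb | moves vis pa
  ... | w ∷ ws | _      = refl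
  ... | []     | w ∷ ws = refl
  ... | []     | []     = refl

other : Player → Player
other alice = bob
other bob   = alice

module Simulation {n : ℕ} (G : Graph n) where
  open Graph G

  F : Graph (suc n)
  F = addApex G

  module TG = Tron G bob ratioBA
  module TF = Tron F alice ratioAB
  module UG = Unfolding G bob ratioBA
  module UF = Unfolding F alice ratioAB

  record Mirrors (visF : TF.Visited) (visG : TG.Visited) : Set where
    field
      apex : visF zero ≡ true
      copy : ∀ u → visF (suc u) ≡ visG u

  visit-mirrors : ∀ {visF visG} x → Mirrors visF visG → Mirrors (TF.visit (suc x) visF) (TG.visit x visG)
  visit-mirrors x m = record
    { apex = apex ; copy = λ u → cong (if does (u ≟ x) then true else_) (copy u) }
    where open Mirrors m

  moves-mirror : ∀ {visF visG} → Mirrors visF visG → ∀ p → TF.moves visF (suc p) ≡ map suc (TG.moves visG p)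
  moves-mirror {visF} m p =
    filter-shift (λ w → Graph.adj F (suc p) w ∧ not (visF w)) _
      (cong not apex) (λ x → cong (λ b → adj p x ∧ not b) (copy x))
    where open Mirrors m

  simulate : ∀ k mv {visF visG} pa pb a b → Mirrors visF visG →
             TG.play k mv visG pa pb a b ≤ℚ TF.play k (other mv) visF (suc pb) (suc pa) (suc b) a
  simulate zero    alice pa pb a b m = ratioBA≤ratioAB a b
  simulate zero    bob   pa pb a b m = ratioBA≤ratioAB a b
  simulate (suc k) alice {visF} {visG} pa pb a b m
    rewrite UG.play-alice k visG pa pb a b | UF.play-bob k visF (suc pb) (suc pa) (suc b) a
          | moves-mirror m pa | moves-mirror m pb
    with TG.moves visG pa | TG.moves visG pb
  ... | w ∷ ws | _      = optimum-mono-suc false _ _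
        (λ x → simulate k bob x pb (suc a) b (visit-mirrors x m)) w ws
  ... | []     | w ∷ ws = optimum-mono-suc true _ _
        (λ x → simulate k alice pa x a (suc b) (visit-mirrors x m)) w ws
  ... | []     | []     = ratioBA≤ratioAB a b
  simulate (suc k) bob {visF} {visG} pa pb a b m
    rewrite UG.play-bob k visG pa pb a b | UF.play-alice k visF (suc pb) (suc pa) (suc b) a
          | moves-mirror m pa | moves-mirror m pb
    with TG.moves visG pb | TG.moves visG pa
  ... | w ∷ ws | _      = optimum-mono-suc true _ _
        (λ x → simulate k alice pa x a (suc b) (visit-mirrors x m)) w ws
  ... | []     | w ∷ ws = optimum-mono-suc false _ _
        (λ x → simulate k bob x pb (suc a) b (visit-mirrors x m)) w ws
  ... | []     | []     = ratioBA≤ratioAB a b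

  none : ∀ {m} → Fin m → Bool
  none _ = false

  bobStarts : Fin n → List (Fin n)
  bobStarts s = filterᵇ (λ u → not (does (u ≟ s))) (allFin n)

  replyG : Fin n → ℚ
  replyG s = TG.choose bob (λ u → TG.play n alice (TG.visit u (TG.visit s none)) s u 1 1) (bobStarts s)

  apexGame : Fin (suc n) → ℚ
  apexGame t = TF.play (suc n) alice (TF.visit t (TF.visit zero none)) zero t 1 1

  apex-moves : ∀ s → TF.moves (TF.visit (suc s) (TF.visit zero none)) zero ≡ map suc (bobStarts s)
  apex-moves s = filter-shift (λ w → Graph.adj F zero w ∧ not (TF.visit (suc s) (TF.visit zero none) w)) _
                   refl copy-unvisited
    where
    copy-unvisited : ∀ x → not (TF.visit (suc s) (TF.visit zero none) (suc x)) ≡ not (does (x ≟ s))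
    copy-unvisited x with does (x ≟ s)
    ... | true  = refl
    ... | false = refl

  -- Opening with the apex: after Alice starts on s in G, the play is worth at
  -- most the F-position with Alice on the apex and Bob on the copy of s, since
  -- Alice's first move in F mirrors Bob's choice of start vertex in G.
  apex-opening : ∀ s → bobStarts s ≢ [] → replyG s ≤ℚ apexGame (suc s)
  apex-opening s nonEmpty
    rewrite UF.play-alice n (TF.visit (suc s) (TF.visit zero none)) zero (suc s) 1 1 | apex-moves s
    with bobStarts s
  ... | []     = ⊥-elim (nonEmpty refl)
  ... | w ∷ ws = optimum-mono-suc true _ _
        (λ u → simulate n alice s u 1 1 (visit-mirrors u initial)) w ws
    where
    initial : Mirrors (TF.visit (suc s) (TF.visit zero none)) (TG.visit s none)
    initial = record { apex = refl ; copy = λ _ → refl }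

  bobStarts-apex : filterᵇ (λ t → not (does (t ≟ zero))) (allFin (suc n)) ≡ map suc (allFin n)
  bobStarts-apex = trans (filter-shift (λ t → not (does (t ≟ zero))) (λ _ → true) refl (λ _ → refl))
                         (cong (map suc) (filter-all (allFin n)))

  start-choice : (∀ s → bobStarts s ≢ []) → ∀ L → TG.choose alice replyG L ≤ℚ TF.choose bob apexGame (map suc L)
  start-choice nonEmpty []       = ≤-refl
  start-choice nonEmpty (w ∷ ws) = optimum-mono-suc false replyG apexGame (λ s → apex-opening s (nonEmpty s)) w ws

  startF : Fin (suc n) → ℚ
  startF s = TF.choose bob (λ t → TF.play (suc n) alice (TF.visit t (TF.visit s none)) s t 1 1)
                           (filterᵇ (λ t → not (does (t ≟ s))) (allFin (suc n)))

  -- Starting on the apex is one of Alice's options in F, so (A/B)_F dominates (B/A)_G.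
  valueBA≤valueAB : (∀ s → bobStarts s ≢ []) → valueBA G ≤ℚ valueAB F
  valueBA≤valueAB nonEmpty = ≤-trans apex-start (seed≤max (startF zero) (map startF (tabulate suc)))
    where
    apex-start : valueBA G ≤ℚ startF zero
    apex-start rewrite bobStarts-apex = start-choice nonEmpty (allFin n)

bobStarts-nonEmpty : ∀ {m} (s : Fin (suc (suc m))) → filterᵇ (λ u → not (does (u ≟ s))) (allFin (suc (suc m))) ≢ []
bobStarts-nonEmpty zero    ()
bobStarts-nonEmpty (suc s) ()

lemma1 : ∀ {n : ℕ} (G : Graph n) → 2 ≤ n → 1ℚ <ℚ valueBA G → valueBA G ≤ℚ valueAB (addApex G)
lemma1 {suc (suc m)} G (s≤s (s≤s z≤n)) _ = Simulation.valueBA≤valueAB G bobStarts-nonEmpty
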